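{- Let $r\ge 1$ be an integer. If a resizable array data structure uses only $N+O(N^{1/r})$ space for storing an array of size $N$, then it must occasionally use $N+\Omega(N^{1-1/r})$ space during a grow operation; that is, for any $(s(N),t(N))$-implementation with $s(N)=O(N^{1/r})$ one has $t(N)=\Omega(N^{1-1/r})$. This holds even if only grow and access operations are performed.
   Context: A resizable array stores a sequence $a_0,\dots,a_{N-1}$ ($N$ is its current size) and supports: creating an empty array, returning its length, reading or overwriting the $i$-th item ($0\le i<N$), Grow$(a)$ which appends a new last item $a$, and Shrink() which removes the last item. An implementation keeps its data in dynamically allocated fixed-length contiguous blocks of memory words; each item occupies one word and each pointer one word; every block other than a single main index block must be pointed to by a pointer stored in some block. The space used at any moment is the total length of all currently allocated blocks. For non-decreasing functions $s,t$, an $(s(N),t(N))$-implementation uses at most $N+s(N)$ space to store an array of size $N$, and at most $N+t(N)$ space at any moment during a grow or shrink operation on an array of size $N$. -}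

module Defs where

open import Data.Nat using (ℕ; suc; _+_; _*_; _^_; _∸_; _≤_; _<_)
open import Data.Nat.ListAction using (sum)
open import Data.Empty using (⊥)
open import Data.Product using (_×_; _,_; proj₁; proj₂; ∃-syntax)
open import Data.Sum using (_⊎_)
open import Data.Unit using (⊤)
open import Data.List using (List; []; _∷_; _++_; map; length; replicate)
open import Data.List.Relation.Unary.Any using (Any)
open import Data.List.Relation.Unary.All using (All)
open import Data.List.Relation.Unary.Unique.Propositional using (Unique)
open import Data.List.Membership.Propositional using (_∈_; _∉_)
open import Relation.Binary.PropositionalEquality using (_≡_)

-- Memory model.
-- A memory word holds an item (items are opaque tokens; item i is the
-- value a_i passed to the i-th Grow), a pointer to a block (by block
-- identifier), or a blank/other value.

data Word : Set where
  item  : ℕ → Word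
  ptr   : ℕ → Word
  blank : Word

Block : Set
Block = ℕ × List Word

Mem : Set
Mem = List Block

ids : Mem → List ℕ
ids = map proj₁

space : Mem → ℕ
space m = sum (map (λ b → length (proj₂ b)) m)

Occurs : Word → Mem → Set
Occurs w m = Any (λ b → w ∈ proj₂ b) m

-- What may be written into a word during the grow on an array of size N:
-- an item already stored in memory, or the new item a_N; any pointer;
-- any other (blank) value.
Available : ℕ → Mem → Word → Set
Available N m (item i) = i ≡ N ⊎ Occurs (item i) m
Available N m (ptr p)  = ⊤
Available N m blank    = ⊤

data Step (N : ℕ) : Mem → Mem → Set where
  alloc : ∀ {m} (b L : ℕ) → b ∉ ids m →
          Step N m ((b , replicate L blank) ∷ m)
  free  : ∀ pre b ws post →
          Step N (pre ++ (b , ws) ∷ post) (pre ++ post)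
  write : ∀ pre b ws₁ w ws₂ post w' →
          Available N (pre ++ (b , ws₁ ++ w ∷ ws₂) ∷ post) w' →
          Step N (pre ++ (b , ws₁ ++ w ∷ ws₂) ∷ post)
                 (pre ++ (b , ws₁ ++ w' ∷ ws₂) ∷ post)

data Trace (N bound : ℕ) : Mem → Mem → Set where
  done : ∀ {m} → space m ≤ bound → Trace N bound m m
  step : ∀ {m m' m''} → space m ≤ bound → Step N m m' →
         Trace N bound m' m'' → Trace N bound m m''

PointerOK : Mem → Set
PointerOK m = ∃[ main ] (main ∈ ids m ×
  All (λ b → proj₁ b ≡ main ⊎ Occurs (ptr (proj₁ b)) m) m)

NoItems : Mem → Set
NoItems m = ∀ i → Occurs (item i) m → ⊥

Stores : (ℕ → ℕ) → ℕ → Mem → Set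
Stores s N m = Unique (ids m) × PointerOK m
             × (∀ i → i < N → Occurs (item i) m)
             × space m ≤ N + s N

Monotone : (ℕ → ℕ) → Set
Monotone f = ∀ {x y} → x ≤ y → f x ≤ f y

-- An (s(N),t(N))-implementation, run on the operation sequence
-- "create, Grow(a_0), Grow(a_1), ..." (plus accesses, which only need the
-- items to be stored): rest N is the memory after N grows, and the N-th
-- grow is a trace from rest N to rest (N+1) within N + t(N) space.
IsImplementation : (s t : ℕ → ℕ) → (ℕ → Mem) → Set
IsImplementation s t rest =
  NoItems (rest 0)
  × (∀ N → Stores s N (rest N))
  × (∀ N → Trace N (N + t N) (rest N) (rest (suc N)))

-- s(N) = O(N^{1/r})  ⇔  ∃ C N₀, ∀ N ≥ N₀, s(N)^r ≤ C·N
BigO-root : (ℕ → ℕ) → ℕ → Set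
BigO-root s r = ∃[ C ] ∃[ N₀ ] (∀ N → N₀ ≤ N → s N ^ r ≤ C * N)

-- t(N) = Ω(N^{1-1/r})  ⇔  ∃ C N₀, ∀ N ≥ N₀, N^{r-1} ≤ C·t(N)^r
BigΩ-root : (ℕ → ℕ) → ℕ → Set
BigΩ-root t r = ∃[ C ] ∃[ N₀ ] (∀ N → N₀ ≤ N → N ^ (r ∸ 1) ≤ C * t N ^ r)

-- An array of size N held in N + s(N) space has at most 1 + s(N) blocks: the N items and one
-- pointer to every non-main block are pairwise distinct words. During the N-th grow only the new
-- item a_N can appear from nowhere, so the N old items stay stored throughout it, and a block
-- allocated then has length at most t(N) (blocks of the initial memory have length at most s(0)).
-- Hence N ≤ (1 + s(N))(s(0) + t(N)); raising this to the r-th power and using s(N)^r ≤ C N gives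
-- N^(r-1) ≤ K t(N)^r.
module Submission where

open import Defs
open import Data.Nat using (ℕ; zero; suc; _+_; _*_; _^_; _≤_; _<_; _⊔_; z≤n; s≤s; _≟_)
open import Data.Nat.Properties
open import Data.Empty using (⊥-elim)
open import Data.Unit using (tt)
open import Data.Product using (_,_; proj₁; proj₂)
open import Data.Sum using (_⊎_; inj₁; inj₂)
open import Data.List using (List; []; _∷_; _++_; map; length; replicate; concat; upTo; filter)
open import Data.List.Properties using (length-++; length-map; length-upTo; length-removeAt′; filter-all; filter-accept; filter-reject)
open import Data.List.Relation.Unary.Any using (here; there; index; _─_)
import Data.List.Relation.Unary.Any.Properties as Any
open import Data.List.Relation.Unary.All using (All; []; _∷_)
import Data.List.Relation.Unary.All as All
import Data.List.Relation.Unary.All.Properties as All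
open import Data.List.Relation.Unary.Unique.Propositional using (Unique)
import Data.List.Relation.Unary.Unique.Propositional.Properties as Unique
open import Data.List.Relation.Unary.AllPairs using ([]; _∷_)
open import Data.List.Relation.Binary.Subset.Propositional using (_⊆_)
open import Data.List.Membership.Propositional using (_∈_; _∉_)
open import Data.List.Membership.Propositional.Properties using (∈-++⁺ˡ; ∈-++⁺ʳ; ∈-++⁻; ∈-map⁻; ∈-upTo⁻; ∈-filter⁻)
open import Data.Nat.Tactic.RingSolver using (solve-∀)
open import Relation.Binary.PropositionalEquality using (_≡_; _≢_; refl; sym; trans; cong; cong₂; subst)
open import Relation.Nullary using (yes; no; ¬?)
open import Relation.Unary using (Decidable)

module _ {A : Set} where

  ∈-─⁺ : ∀ {x v : A} {ys} (x∈ys : x ∈ ys) → v ∈ ys → v ≢ x → v ∈ (ys ─ x∈ys)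
  ∈-─⁺ (here refl) (here v≡x) v≢x = ⊥-elim (v≢x v≡x)
  ∈-─⁺ (here refl) (there v∈ys) _ = v∈ys
  ∈-─⁺ (there _)   (here v≡y)   _ = here v≡y
  ∈-─⁺ (there x∈ys) (there v∈ys) v≢x = there (∈-─⁺ x∈ys v∈ys v≢x)

  Unique-⊆⇒length-≤ : ∀ {xs ys : List A} → Unique xs → xs ⊆ ys → length xs ≤ length ys
  Unique-⊆⇒length-≤ {[]} _ _ = z≤n
  Unique-⊆⇒length-≤ {x ∷ xs} {ys} (x∉xs ∷ u) xs⊆ys = begin
    suc (length xs)          ≤⟨ s≤s (Unique-⊆⇒length-≤ u rest⊆) ⟩
    suc (length (ys ─ x∈ys)) ≡⟨ sym (length-removeAt′ ys (index x∈ys)) ⟩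
    length ys                ∎
    where
    open ≤-Reasoning
    x∈ys : x ∈ ys
    x∈ys = xs⊆ys (here refl)
    rest⊆ : xs ⊆ (ys ─ x∈ys)
    rest⊆ v∈xs = ∈-─⁺ x∈ys (xs⊆ys (there v∈xs)) (λ v≡x → All.lookup x∉xs v∈xs (sym v≡x))

contents : Mem → List Word
contents m = concat (map proj₂ m)

space≡length-contents : ∀ m → space m ≡ length (contents m)
space≡length-contents [] = refl
space≡length-contents ((_ , ws) ∷ m) =
  trans (cong (length ws +_) (space≡length-contents m)) (sym (length-++ ws))

Occurs⇒∈contents : ∀ {w} m → Occurs w m → w ∈ contents m
Occurs⇒∈contents (_ ∷ m) (here w∈ws) = ∈-++⁺ˡ w∈ws
Occurs⇒∈contents ((_ , ws) ∷ m) (there o) = ∈-++⁺ʳ ws (Occurs⇒∈contents m o)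

HoldsItems : ℕ → Mem → Set
HoldsItems N m = ∀ i → i < N → Occurs (item i) m

items : ℕ → List Word
items N = map item (upTo N)

Unique-items : ∀ N → Unique (items N)
Unique-items N = Unique.map⁺ (λ { refl → refl }) (Unique.upTo⁺ N)

length-items : ∀ N → length (items N) ≡ N
length-items N = trans (length-map item (upTo N)) (length-upTo N)

HoldsItems⇒items⊆contents : ∀ {N m} → HoldsItems N m → items N ⊆ contents m
HoldsItems⇒items⊆contents {m = m} held v∈items with ∈-map⁻ item v∈items
... | i , i∈upTo , refl = Occurs⇒∈contents m (held i (∈-upTo⁻ i∈upTo))

HoldsItems⇒≤space : ∀ {N m} → HoldsItems N m → N ≤ space m
HoldsItems⇒≤space {N} {m} held = begin
  N                    ≡⟨ sym (length-items N) ⟩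
  length (items N)     ≤⟨ Unique-⊆⇒length-≤ (Unique-items N) (HoldsItems⇒items⊆contents held) ⟩
  length (contents m)  ≡⟨ sym (space≡length-contents m) ⟩
  space m              ∎
  where open ≤-Reasoning

Occurs⇒Available : ∀ {M w} m → Occurs w m → Available M m w
Occurs⇒Available {w = item i} _ o = inj₂ o
Occurs⇒Available {w = ptr p}  _ _ = tt
Occurs⇒Available {w = blank}  _ _ = tt

Occurs-replace : ∀ {w} pre blk blk' post →
  Occurs w (pre ++ blk' ∷ post) → w ∈ proj₂ blk' ⊎ Occurs w (pre ++ blk ∷ post)
Occurs-replace pre blk blk' post o with Any.++⁻ pre o
... | inj₁ o-pre          = inj₂ (Any.++⁺ˡ o-pre)
... | inj₂ (here w∈blk')  = inj₁ w∈blk'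
... | inj₂ (there o-post) = inj₂ (Any.++⁺ʳ pre (there o-post))

Step⇒Available : ∀ {M m m' w} → Step M m m' → Occurs w m' → Available M m w
Step⇒Available (alloc b L _) (here w∈blanks)
  rewrite All.lookup (All.replicate⁺ {P = _≡ blank} L refl) w∈blanks = tt
Step⇒Available {m = m} (alloc b L _) (there o) = Occurs⇒Available m o
Step⇒Available (free pre b ws post) o with Any.++⁻ pre o
... | inj₁ o-pre  = Occurs⇒Available _ (Any.++⁺ˡ o-pre)
... | inj₂ o-post = Occurs⇒Available _ (Any.++⁺ʳ pre (there o-post))
Step⇒Available (write pre b ws₁ w ws₂ post w' w'-avail) o
  with Occurs-replace pre (b , ws₁ ++ w ∷ ws₂) (b , ws₁ ++ w' ∷ ws₂) post o
... | inj₂ o-old = Occurs⇒Available _ o-old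
... | inj₁ ∈blk with ∈-++⁻ ws₁ ∈blk
...   | inj₁ ∈ws₁          = Occurs⇒Available _ (Any.++⁺ʳ pre (here (∈-++⁺ˡ ∈ws₁)))
...   | inj₂ (here refl)   = w'-avail
...   | inj₂ (there ∈ws₂)  = Occurs⇒Available _ (Any.++⁺ʳ pre (here (∈-++⁺ʳ ws₁ (there ∈ws₂))))

Trace-reflects-HoldsItems : ∀ {M bound m m'} → Trace M bound m m' → HoldsItems M m' → HoldsItems M m
Trace-reflects-HoldsItems (done _) held = held
Trace-reflects-HoldsItems (step _ st tr) held i i<M
  with Step⇒Available st (Trace-reflects-HoldsItems tr held i i<M)
... | inj₁ i≡M = ⊥-elim (<⇒≢ i<M i≡M)
... | inj₂ o   = o

space-start≤ : ∀ {M bound m m'} → Trace M bound m m' → space m ≤ bound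
space-start≤ (done sp≤) = sp≤
space-start≤ (step sp≤ _ _) = sp≤

space-end≤ : ∀ {M bound m m'} → Trace M bound m m' → space m' ≤ bound
space-end≤ (done sp≤) = sp≤
space-end≤ (step _ _ tr) = space-end≤ tr

MaxBlock : ℕ → Mem → Set
MaxBlock L m = All (λ b → length (proj₂ b) ≤ L) m

MaxBlock-mono : ∀ {L L'} → L ≤ L' → ∀ {m} → MaxBlock L m → MaxBlock L' m
MaxBlock-mono L≤L' = All.map (λ ≤L → ≤-trans ≤L L≤L')

MaxBlock-space : ∀ m → MaxBlock (space m) m
MaxBlock-space [] = []
MaxBlock-space ((_ , ws) ∷ m) =
  m≤m+n (length ws) (space m) ∷ MaxBlock-mono (m≤n+m (space m) (length ws)) (MaxBlock-space m)

space≤blocks*MaxBlock : ∀ {L} m → MaxBlock L m → space m ≤ length m * L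
space≤blocks*MaxBlock [] [] = z≤n
space≤blocks*MaxBlock (_ ∷ m) (≤L ∷ ≤Ls) = +-mono-≤ ≤L (space≤blocks*MaxBlock m ≤Ls)

Step-preserves-MaxBlock : ∀ {M L m m'} → Step M m m' → space m' ≤ M + L → M ≤ space m →
  MaxBlock L m → MaxBlock L m'
Step-preserves-MaxBlock {M} {L} {m} (alloc b L' _) sp≤ M≤sp ≤Ls =
  +-cancelʳ-≤ M (length (replicate L' blank)) L (begin
    length (replicate L' blank) + M        ≤⟨ +-monoʳ-≤ _ M≤sp ⟩
    length (replicate L' blank) + space m  ≤⟨ sp≤ ⟩
    M + L                                  ≡⟨ +-comm M L ⟩
    L + M                                  ∎) ∷ ≤Ls
  where open ≤-Reasoning
Step-preserves-MaxBlock (free pre b ws post) _ _ ≤Ls with All.++⁻ pre ≤Ls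
... | ≤Ls-pre , _ ∷ ≤Ls-post = All.++⁺ ≤Ls-pre ≤Ls-post
Step-preserves-MaxBlock (write pre b ws₁ w ws₂ post w' _) _ _ ≤Ls with All.++⁻ pre ≤Ls
... | ≤Ls-pre , ≤L ∷ ≤Ls-post = All.++⁺ ≤Ls-pre (subst (_≤ _) same-length ≤L ∷ ≤Ls-post)
  where
  same-length : length (ws₁ ++ w ∷ ws₂) ≡ length (ws₁ ++ w' ∷ ws₂)
  same-length = trans (length-++ ws₁) (sym (length-++ ws₁))

Trace-preserves-MaxBlock : ∀ {M bound L m m'} → Trace M bound m m' → bound ≤ M + L →
  HoldsItems M m' → MaxBlock L m → MaxBlock L m'
Trace-preserves-MaxBlock (done _) _ _ ≤Ls = ≤Ls
Trace-preserves-MaxBlock tr₀@(step _ st tr) bound≤ held ≤Ls =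
  Trace-preserves-MaxBlock tr bound≤ held
    (Step-preserves-MaxBlock st (≤-trans (space-start≤ tr) bound≤)
      (HoldsItems⇒≤space (Trace-reflects-HoldsItems tr₀ held)) ≤Ls)

≢? : (a : ℕ) → Decidable (_≢ a)
≢? a x = ¬? (x ≟ a)

Unique⇒length-≤-suc-filter-≢ : ∀ a {xs : List ℕ} → Unique xs → length xs ≤ suc (length (filter (≢? a) xs))
Unique⇒length-≤-suc-filter-≢ a {[]} [] = z≤n
Unique⇒length-≤-suc-filter-≢ a {x ∷ xs} (x∉xs ∷ u) with x ≟ a
... | yes refl rewrite filter-reject (≢? a) {x} {xs} (λ x≢x → x≢x refl)
                     | filter-all (≢? a) (All.map (λ x≢v v≡x → x≢v (sym v≡x)) x∉xs) = ≤-refl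
... | no x≢a rewrite filter-accept (≢? a) {x} {xs} x≢a = s≤s (Unique⇒length-≤-suc-filter-≢ a u)

items∌ptr : ∀ {N ps v} → v ∈ items N → v ∉ map ptr ps
items∌ptr v∈items v∈ptrs with ∈-map⁻ item v∈items | ∈-map⁻ ptr v∈ptrs
... | _ , _ , refl | _ , _ , ()

Stores⇒blocks≤ : ∀ {s N m} → Stores s N m → length m ≤ suc (s N)
Stores⇒blocks≤ {s} {N} {m} (unique-ids , (main , _ , pointed) , held , sp≤) = begin
  length m                 ≡⟨ sym (length-map proj₁ m) ⟩
  length (ids m)           ≤⟨ Unique⇒length-≤-suc-filter-≢ main unique-ids ⟩
  suc (length others)      ≤⟨ s≤s (+-cancelˡ-≤ N (length others) (s N) N+others≤) ⟩
  suc (s N)                ∎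
  where
  open ≤-Reasoning
  others : List ℕ
  others = filter (≢? main) (ids m)

  words : List Word
  words = items N ++ map ptr others

  Unique-words : Unique words
  Unique-words = Unique.++⁺ (Unique-items N) (Unique.map⁺ (λ { refl → refl }) (Unique.filter⁺ (≢? main) unique-ids))
    λ (v∈items , v∈ptrs) → items∌ptr v∈items v∈ptrs

  words⊆contents : words ⊆ contents m
  words⊆contents v∈words with ∈-++⁻ (items N) v∈words
  ... | inj₁ v∈items = HoldsItems⇒items⊆contents held v∈items
  ... | inj₂ v∈ptrs with ∈-map⁻ ptr v∈ptrs
  ... | p , p∈others , refl with ∈-filter⁻ (≢? main) {xs = ids m} p∈others
  ... | p∈ids , p≢main with ∈-map⁻ proj₁ p∈ids
  ... | blk , blk∈m , refl with All.lookup pointed blk∈m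
  ... | inj₁ p≡main = ⊥-elim (p≢main p≡main)
  ... | inj₂ o      = Occurs⇒∈contents m o

  N+others≤ : N + length others ≤ N + s N
  N+others≤ = begin
    N + length others    ≡⟨ cong₂ _+_ (sym (length-items N)) (sym (length-map ptr others)) ⟩
    length (items N) + length (map ptr others) ≡⟨ sym (length-++ (items N)) ⟩
    length words         ≤⟨ Unique-⊆⇒length-≤ Unique-words words⊆contents ⟩
    length (contents m)  ≡⟨ sym (space≡length-contents m) ⟩
    space m              ≤⟨ sp≤ ⟩
    N + s N              ∎

module _ {s t : ℕ → ℕ} {rest : ℕ → Mem} (impl : IsImplementation s t rest) where

  private
    stored : ∀ N → Stores s N (rest N)
    stored = proj₁ (proj₂ impl)

    grow : ∀ N → Trace N (N + t N) (rest N) (rest (suc N))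
    grow = proj₂ (proj₂ impl)

    held : ∀ N → HoldsItems N (rest N)
    held N = proj₁ (proj₂ (proj₂ (stored N)))

    space≤ : ∀ N → space (rest N) ≤ N + s N
    space≤ N = proj₂ (proj₂ (proj₂ (stored N)))

  Implementation⇒1≤t : ∀ N → 1 ≤ t N
  Implementation⇒1≤t N = +-cancelˡ-≤ N 1 (t N) (begin
    N + 1                ≡⟨ +-comm N 1 ⟩
    suc N                ≤⟨ HoldsItems⇒≤space (held (suc N)) ⟩
    space (rest (suc N)) ≤⟨ space-end≤ (grow N) ⟩
    N + t N              ∎)
    where open ≤-Reasoning

  Implementation⇒MaxBlock : Monotone t → ∀ N → MaxBlock (s 0 + t N) (rest N)
  Implementation⇒MaxBlock t-mono zero =
    MaxBlock-mono (≤-trans (space≤ 0) (m≤m+n (s 0) (t 0))) (MaxBlock-space (rest 0))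
  Implementation⇒MaxBlock t-mono (suc N) =
    MaxBlock-mono (+-monoʳ-≤ (s 0) (t-mono (n≤1+n N)))
      (Trace-preserves-MaxBlock (grow N) (+-monoʳ-≤ N (m≤n+m (t N) (s 0)))
        (λ i i<N → held (suc N) i (m<n⇒m<1+n i<N))
        (Implementation⇒MaxBlock t-mono N))

  Implementation⇒N≤[1+sN]*[s0+tN] : Monotone t → ∀ N → N ≤ suc (s N) * (s 0 + t N)
  Implementation⇒N≤[1+sN]*[s0+tN] t-mono N = begin
    N                                  ≤⟨ HoldsItems⇒≤space (held N) ⟩
    space (rest N)                     ≤⟨ space≤blocks*MaxBlock (rest N) (Implementation⇒MaxBlock t-mono N) ⟩
    length (rest N) * (s 0 + t N)      ≤⟨ *-monoˡ-≤ (s 0 + t N) (Stores⇒blocks≤ {s} (stored N)) ⟩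
    suc (s N) * (s 0 + t N)            ∎
    where open ≤-Reasoning

^-distribʳ-* : ∀ m n r → (m * n) ^ r ≡ m ^ r * n ^ r
^-distribʳ-* m n zero = refl
^-distribʳ-* m n (suc r) = trans (cong (m * n *_) (^-distribʳ-* m n r)) (interchange m n (m ^ r) (n ^ r))
  where
  interchange : ∀ a b c d → a * b * (c * d) ≡ a * c * (b * d)
  interchange = solve-∀

[1+n]^r≤2^r*[1+n^r] : ∀ n r → suc n ^ r ≤ 2 ^ r * suc (n ^ r)
[1+n]^r≤2^r*[1+n^r] zero r = begin
  1 ^ r                ≡⟨ ^-zeroˡ r ⟩
  1                    ≤⟨ m^n>0 2 r ⟩
  2 ^ r                ≤⟨ m≤m*n (2 ^ r) (suc (0 ^ r)) ⟩
  2 ^ r * suc (0 ^ r)  ∎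
  where open ≤-Reasoning
[1+n]^r≤2^r*[1+n^r] (suc n) r = begin
  suc (suc n) ^ r          ≤⟨ ^-monoˡ-≤ r (+-monoˡ-≤ (suc n) (s≤s z≤n)) ⟩
  (suc n + suc n) ^ r      ≡⟨ cong (_^ r) (double (suc n)) ⟩
  (2 * suc n) ^ r          ≡⟨ ^-distribʳ-* 2 (suc n) r ⟩
  2 ^ r * suc n ^ r        ≤⟨ *-monoʳ-≤ (2 ^ r) (n≤1+n (suc n ^ r)) ⟩
  2 ^ r * suc (suc n ^ r)  ∎
  where
  open ≤-Reasoning
  double : ∀ x → x + x ≡ 2 * x
  double = solve-∀

-- r = q + 1; the factor N gained from S ^ r ≤ C N is cancelled at the end.
size-tradeoff : ∀ q C a {N S T} → 1 ≤ N → 1 ≤ T → N ≤ suc S * (a + T) → S ^ suc q ≤ C * N →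
  N ^ q ≤ (2 ^ suc q * (C + 1) * suc a ^ suc q) * T ^ suc q
size-tradeoff q C a {N@(suc _)} {S} {T} 1≤N 1≤T N≤ S^r≤CN = *-cancelˡ-≤ N (begin
  N ^ r                                   ≤⟨ ^-monoˡ-≤ r (≤-trans N≤ (*-monoʳ-≤ (suc S) a+T≤)) ⟩
  (suc S * (suc a * T)) ^ r               ≡⟨ trans (^-distribʳ-* (suc S) (suc a * T) r) (cong (suc S ^ r *_) (^-distribʳ-* (suc a) T r)) ⟩
  suc S ^ r * (suc a ^ r * T ^ r)         ≤⟨ *-monoˡ-≤ _ (≤-trans ([1+n]^r≤2^r*[1+n^r] S r) (*-monoʳ-≤ (2 ^ r) 1+S^r≤)) ⟩
  2 ^ r * ((C + 1) * N) * (suc a ^ r * T ^ r)  ≡⟨ regroup N (2 ^ r) C (suc a ^ r) (T ^ r) ⟩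
  N * ((2 ^ r * (C + 1) * suc a ^ r) * T ^ r)  ∎)
  where
  open ≤-Reasoning
  r : ℕ
  r = suc q
  a+T≤ : a + T ≤ suc a * T
  a+T≤ = begin
    a + T      ≤⟨ +-monoˡ-≤ T (≤-trans (≤-reflexive (sym (*-identityʳ a))) (*-monoʳ-≤ a 1≤T)) ⟩
    a * T + T  ≡⟨ +-comm (a * T) T ⟩
    suc a * T  ∎
  1+S^r≤ : suc (S ^ r) ≤ (C + 1) * N
  1+S^r≤ = begin
    1 + S ^ r  ≤⟨ +-mono-≤ 1≤N S^r≤CN ⟩
    N + C * N  ≡⟨ collect C N ⟩
    (C + 1) * N ∎
    where
    collect : ∀ c n → n + c * n ≡ (c + 1) * n
    collect = solve-∀
  regroup : ∀ n k c b t → k * ((c + 1) * n) * (b * t) ≡ n * (k * (c + 1) * b * t)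
  regroup = solve-∀

corollary4p3 : (r : ℕ) → 1 ≤ r → (s t : ℕ → ℕ) → Monotone s → Monotone t →
    (rest : ℕ → Mem) → IsImplementation s t rest →
    BigO-root s r → BigΩ-root t r
corollary4p3 zero () _ _ _ _ _ _ _
corollary4p3 (suc q) _ s t _ t-mono rest impl (C , N₀ , s^r≤CN) =
  2 ^ suc q * (C + 1) * suc (s 0) ^ suc q , N₀ ⊔ 1 , λ N N₀⊔1≤N →
    size-tradeoff q C (s 0) {S = s N} (≤-trans (m≤n⊔m N₀ 1) N₀⊔1≤N) (Implementation⇒1≤t impl N)
      (Implementation⇒N≤[1+sN]*[s0+tN] impl t-mono N) (s^r≤CN N (≤-trans (m≤m⊔n N₀ 1) N₀⊔1≤N))
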